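{- Let $G$ be a graph with at least one edge. If $G$ has a spanning elementary subgraph, then $\gamma'_s(G)\geq 0$.
   Context: All graphs are finite, simple and undirected. An elementary graph is a graph each of whose components is $1$-regular (a single edge) or $2$-regular (a cycle); a spanning elementary subgraph of $G$ is an elementary subgraph containing all vertices of $G$. For an edge $e=uv$, $N[e]$ denotes the set of edges of $G$ sharing at least one endpoint with $e$ (including $e$ itself). For a graph $G$ with at least one edge, a function $f:E(G)\to\{ -1,1\}$ is a signed edge domination function (SEDF) if $\sum_{e'\in N[e]}f(e')\geq 1$ for every $e\in E(G)$. The signed edge domination number is $\gamma'_s(G)=\min\{\sum_{e\in E(G)}f(e) : f \text{ is an SEDF of } G\}$. -}

module Defs where

open import Data.Nat using (ℕ; _<ᵇ_)
open import Data.Bool using (Bool; true; false; _∧_; _∨_)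
open import Data.Fin using (Fin; toℕ; _≟_)
open import Data.Product using (_×_; _,_; proj₁; proj₂; Σ; ∃-syntax)
open import Data.Sum using (_⊎_)
open import Data.List using (List; []; _∷_; map; filterᵇ; cartesianProduct; allFin; length)
open import Data.Integer using (ℤ; +_; -_; _+_; _≤_)
open import Data.Sign using (Sign)
open import Relation.Nullary.Decidable using (⌊_⌋)
open import Relation.Binary.PropositionalEquality using (_≡_)

record Graph : Set where
  field
    n      : ℕ
    adj    : Fin n → Fin n → Bool
    sym    : ∀ i j → adj i j ≡ adj j i
    irrefl : ∀ i → adj i i ≡ false

open Graph public

-- An edge {i,j} is represented by the ordered pair (i , j) with i < j.
Edge : Graph → Set
Edge G = Fin (n G) × Fin (n G)

isEdge : (G : Graph) → Edge G → Bool
isEdge G (i , j) = (toℕ i <ᵇ toℕ j) ∧ adj G i j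

edges : (G : Graph) → List (Edge G)
edges G = filterᵇ (isEdge G) (cartesianProduct (allFin (n G)) (allFin (n G)))

HasEdge : Graph → Set
HasEdge G = ∃[ i ] ∃[ j ] (adj G i j ≡ true)

-- e and e' share at least one endpoint (e' ∈ N[e], including e itself).
shareEnd : (G : Graph) → Edge G → Edge G → Bool
shareEnd G (a , b) (c , d) =
  ⌊ a ≟ c ⌋ ∨ ⌊ a ≟ d ⌋ ∨ ⌊ b ≟ c ⌋ ∨ ⌊ b ≟ d ⌋

-- Edge functions with values in {-1, 1} (a Sign per edge; only its values on
-- the edges of G matter).
EdgeFun : Graph → Set
EdgeFun G = Edge G → Sign

val : Sign → ℤ
val Sign.+ = + 1
val Sign.- = - (+ 1)

sumℤ : List ℤ → ℤ
sumℤ []       = + 0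
sumℤ (x ∷ xs) = x + sumℤ xs

nbhdSum : (G : Graph) → EdgeFun G → Edge G → ℤ
nbhdSum G f e = sumℤ (map (λ e' → val (f e')) (filterᵇ (shareEnd G e) (edges G)))

weight : (G : Graph) → EdgeFun G → ℤ
weight G f = sumℤ (map (λ e → val (f e)) (edges G))

IsSEDF : (G : Graph) → EdgeFun G → Set
IsSEDF G f = ∀ e → isEdge G e ≡ true → + 1 ≤ nbhdSum G f e

record EdgeSubgraph (G : Graph) : Set where
  field
    hadj : Fin (n G) → Fin (n G) → Bool
    hsym : ∀ i j → hadj i j ≡ hadj j i
    hsub : ∀ i j → hadj i j ≡ true → adj G i j ≡ true

open EdgeSubgraph public

degH : {G : Graph} → EdgeSubgraph G → Fin (n G) → ℕ
degH {G} H v = length (filterᵇ (hadj H v) (allFin (n G)))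

-- H, viewed as a spanning subgraph (all vertices of G), is elementary: every
-- component is 1-regular or 2-regular.  Since degree is constant on a
-- component iff it is equal at the two ends of every edge, this says:
-- every vertex has H-degree 1 or 2, and adjacent vertices have equal H-degree.
IsSpanningElementary : {G : Graph} → EdgeSubgraph G → Set
IsSpanningElementary {G} H =
  (∀ v → degH H v ≡ 1 ⊎ degH H v ≡ 2) ×
  (∀ u v → hadj H u v ≡ true → degH H u ≡ degH H v)

HasSpanningElementary : Graph → Set
HasSpanningElementary G = Σ (EdgeSubgraph G) IsSpanningElementary

module Submission where

-- For an edge function f and a vertex v let f(E(v)) be the sum of f over the
-- edges at v.  The proof combines three facts.
--   (1) Handshake: Σ_v f(E(v)) = 2 f(E(G)), as every edge has two ends.
--   (2) For an edge ab the edges sharing an end with ab are the edges at a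
--       together with the edges at b, and ab is the only edge at both, so
--       f(N[ab]) + f(ab) = f(E(a)) + f(E(b)).  For an SEDF f this yields
--       f(E(a)) + f(E(b)) ≥ 1 + (-1) = 0 for every edge ab.
--   (3) Weighting: if w ≥ 0 is a symmetric weighting of vertex pairs whose
--       row sums all equal k > 0, and s(v) + s(u) ≥ 0 whenever w(v,u) > 0,
--       then Σ_v s(v) ≥ 0, since 0 ≤ Σ_{v,u} w(v,u)(s(v) + s(u)) = 2k Σ_v s(v).
-- A spanning elementary subgraph H gives such a weighting with k = 2, namely
-- w(v,u) = 2 / deg_H(v) for vu ∈ H; it is symmetric because the H-degree is
-- constant along H-edges.

open import Defs hiding (sym)
open import Data.Integer using (+_; _≤_)
open import Data.Integer as ℤ using (ℤ; 0ℤ; _+_; _*_; -[1+_]; +≤+; -≤+)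
import Data.Integer.Properties as ℤP
open import Algebra.Properties.Semiring.Sum ℤP.+-*-semiring using (sum; sum-syntax; ∑-comm; ∑-distrib-+; sum-cong-≗; sum-remove; sum-replicate-zero; *-distribˡ-sum; *-distribʳ-sum)
open import Data.Nat as ℕ using (ℕ; zero; suc)
import Data.Nat.Properties as ℕP
open import Data.Fin using (Fin; zero; suc; toℕ; _≟_; punchIn)
open import Data.Fin.Properties using (punchInᵢ≢i; toℕ-injective)
open import Data.Bool using (Bool; true; false; if_then_else_; _∧_; _∨_)
open import Data.Bool.Properties using (T-≡; T-∧; ∨-assoc; ∨-zeroʳ)
open import Data.Empty using (⊥-elim)
open import Data.List using (List; []; _∷_; map; filterᵇ; cartesianProduct; allFin; length; _++_; tabulate)
open import Data.List.Properties using (map-∘)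
open import Data.Product using (_×_; _,_; proj₁; proj₂)
open import Data.Sum using (_⊎_; inj₁; inj₂)
open import Data.Sign using (Sign)
open import Function using (_∘_; id)
open import Function.Bundles using (Equivalence)
open import Relation.Binary.Definitions using (tri<; tri≈; tri>)
open import Relation.Binary.PropositionalEquality using (_≡_; _≢_; refl; sym; trans; cong; cong₂; subst; module ≡-Reasoning)
open import Relation.Nullary.Decidable using (⌊_⌋; yes; no)
open ≡-Reasoning

infixr 8 [_]·_
[_]·_ : Bool → ℤ → ℤ
[ b ]· x = if b then x else 0ℤ

[]·-distrib-+ : ∀ b x y → [ b ]· (x + y) ≡ [ b ]· x + [ b ]· y
[]·-distrib-+ true  x y = refl
[]·-distrib-+ false x y = refl

-- Inclusion–exclusion for two indicators, in subtraction-free form.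
[]·-∨-∧ : ∀ p q x → [ p ∨ q ]· x + [ p ∧ q ]· x ≡ [ p ]· x + [ q ]· x
[]·-∨-∧ true  true  x = refl
[]·-∨-∧ true  false x = refl
[]·-∨-∧ false true  x = ℤP.+-comm x 0ℤ
[]·-∨-∧ false false x = refl

⌊≟⌋-diag : ∀ {m} (a : Fin m) → ⌊ a ≟ a ⌋ ≡ true
⌊≟⌋-diag a with a ≟ a
... | yes _   = refl
... | no a≢a = ⊥-elim (a≢a refl)

⌊≟⌋-off : ∀ {m} {v a : Fin m} → v ≢ a → ⌊ v ≟ a ⌋ ≡ false
⌊≟⌋-off {v = v} {a} v≢a with v ≟ a
... | yes v≡a = ⊥-elim (v≢a v≡a)
... | no _    = refl

∑-nonneg : ∀ {m} (g : Fin m → ℤ) → (∀ i → 0ℤ ≤ g i) → 0ℤ ≤ ∑[ i < m ] g i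
∑-nonneg {zero}  g g≥0 = ℤP.≤-refl
∑-nonneg {suc m} g g≥0 = ℤP.+-mono-≤ (g≥0 zero) (∑-nonneg (g ∘ suc) (g≥0 ∘ suc))

∑-delta : ∀ {m} (g : Fin m → ℤ) (a : Fin m) → (∀ i → i ≢ a → g i ≡ 0ℤ) →
  ∑[ i < m ] g i ≡ g a
∑-delta {suc m} g a vanish = begin
  sum g                            ≡⟨ sum-remove {i = a} g ⟩
  g a + ∑[ j < m ] g (punchIn a j)  ≡⟨ cong (_+_ (g a)) rest≡0 ⟩
  g a + 0ℤ                         ≡⟨ ℤP.+-identityʳ (g a) ⟩
  g a                              ∎
  where
  rest≡0 : ∑[ j < m ] g (punchIn a j) ≡ 0ℤ
  rest≡0 = trans (sum-cong-≗ (λ j → vanish (punchIn a j) (punchInᵢ≢i a j)))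
                 (sum-replicate-zero m)

∑² : ∀ {m} → (Fin m × Fin m → ℤ) → ℤ
∑² {m} φ = ∑[ c < m ] ∑[ d < m ] φ (c , d)

∑²-cong : ∀ {m} {φ ψ : Fin m × Fin m → ℤ} → (∀ e → φ e ≡ ψ e) → ∑² φ ≡ ∑² ψ
∑²-cong φ≗ψ = sum-cong-≗ (λ c → sum-cong-≗ (λ d → φ≗ψ (c , d)))

∑²-distrib-+ : ∀ {m} (φ ψ : Fin m × Fin m → ℤ) →
  ∑² (λ e → φ e + ψ e) ≡ ∑² φ + ∑² ψ
∑²-distrib-+ {m} φ ψ =
  trans (sum-cong-≗ (λ c → ∑-distrib-+ (λ d → φ (c , d)) (λ d → ψ (c , d))))
        (∑-distrib-+ (λ c → ∑[ d < m ] φ (c , d)) (λ c → ∑[ d < m ] ψ (c , d)))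

∑²-delta : ∀ {m} (φ : Fin m × Fin m → ℤ) (e : Fin m × Fin m) →
  (∀ e′ → e′ ≢ e → φ e′ ≡ 0ℤ) → ∑² φ ≡ φ e
∑²-delta {m} φ (a , b) vanish =
  trans (sum-cong-≗ row) (∑-delta (λ c → φ (c , b)) a (λ c c≢a → vanish (c , b) (c≢a ∘ cong proj₁)))
  where
  row : ∀ c → ∑[ d < m ] φ (c , d) ≡ φ (c , b)
  row c = ∑-delta (λ d → φ (c , d)) b (λ d d≢b → vanish (c , d) (d≢b ∘ cong proj₂))

module _ {A : Set} where

  sumℤ-map-++ : (g : A → ℤ) (xs ys : List A) →
    sumℤ (map g (xs ++ ys)) ≡ sumℤ (map g xs) + sumℤ (map g ys)
  sumℤ-map-++ g []       ys = sym (ℤP.+-identityˡ _)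
  sumℤ-map-++ g (x ∷ xs) ys =
    trans (cong (_+_ (g x)) (sumℤ-map-++ g xs ys)) (sym (ℤP.+-assoc (g x) _ _))

  sumℤ-map-filter : (g : A → ℤ) (p : A → Bool) (xs : List A) →
    sumℤ (map g (filterᵇ p xs)) ≡ sumℤ (map (λ x → [ p x ]· g x) xs)
  sumℤ-map-filter g p [] = refl
  sumℤ-map-filter g p (x ∷ xs) with p x
  ... | true  = cong (_+_ (g x)) (sumℤ-map-filter g p xs)
  ... | false = trans (sumℤ-map-filter g p xs) (sym (ℤP.+-identityˡ _))

  sumℤ-map-tabulate : ∀ {m} (g : A → ℤ) (h : Fin m → A) →
    sumℤ (map g (tabulate h)) ≡ ∑[ i < m ] g (h i)
  sumℤ-map-tabulate {zero}  g h = refl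
  sumℤ-map-tabulate {suc m} g h = cong (_+_ (g (h zero))) (sumℤ-map-tabulate g (h ∘ suc))

  sumℤ-count : (p : A → Bool) (x : ℤ) (xs : List A) →
    sumℤ (map (λ a → [ p a ]· x) xs) ≡ + length (filterᵇ p xs) * x
  sumℤ-count p x [] = refl
  sumℤ-count p x (a ∷ xs) with p a
  ... | true  = trans (cong (_+_ x) (sumℤ-count p x xs)) (sym (ℤP.suc-* (+ length (filterᵇ p xs)) x))
  ... | false = trans (ℤP.+-identityˡ _) (sumℤ-count p x xs)

sumℤ-map-cartesianProduct : {A B : Set} (g : A × B → ℤ) (xs : List A) (ys : List B) →
  sumℤ (map g (cartesianProduct xs ys)) ≡ sumℤ (map (λ x → sumℤ (map (λ y → g (x , y)) ys)) xs)
sumℤ-map-cartesianProduct g []       ys = refl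
sumℤ-map-cartesianProduct g (x ∷ xs) ys =
  trans (sumℤ-map-++ g (map (x ,_) ys) (cartesianProduct xs ys))
        (cong₂ _+_ (cong sumℤ (sym (map-∘ ys))) (sumℤ-map-cartesianProduct g xs ys))

∑-count : ∀ {m} (p : Fin m → Bool) (x : ℤ) →
  ∑[ i < m ] ([ p i ]· x) ≡ + length (filterᵇ p (allFin m)) * x
∑-count p x = trans (sym (sumℤ-map-tabulate (λ i → [ p i ]· x) id)) (sumℤ-count p x (allFin _))

sumℤ-edges : (G : Graph) (φ : Edge G → ℤ) →
  sumℤ (map φ (edges G)) ≡ ∑² (λ e → [ isEdge G e ]· φ e)
sumℤ-edges G φ = begin
  sumℤ (map φ (edges G))
    ≡⟨ sumℤ-map-filter φ (isEdge G) (cartesianProduct V V) ⟩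
  sumℤ (map ψ (cartesianProduct V V))
    ≡⟨ sumℤ-map-cartesianProduct ψ V V ⟩
  sumℤ (map (λ c → sumℤ (map (λ d → ψ (c , d)) V)) V)
    ≡⟨ sumℤ-map-tabulate (λ c → sumℤ (map (λ d → ψ (c , d)) V)) id ⟩
  ∑[ c < n G ] sumℤ (map (λ d → ψ (c , d)) V)
    ≡⟨ sum-cong-≗ (λ c → sumℤ-map-tabulate (λ d → ψ (c , d)) id) ⟩
  ∑² ψ ∎
  where
  V : List (Fin (n G))
  V = allFin (n G)
  ψ : Edge G → ℤ
  ψ e = [ isEdge G e ]· φ e

infix 7 _∈ₑ_
_∈ₑ_ : ∀ {m} → Fin m → Fin m × Fin m → Bool
v ∈ₑ (c , d) = ⌊ v ≟ c ⌋ ∨ ⌊ v ≟ d ⌋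

∈ₑ-sound : ∀ {m} {v c d : Fin m} → v ∈ₑ (c , d) ≡ true → v ≡ c ⊎ v ≡ d
∈ₑ-sound {v = v} {c} {d} v∈ with v ≟ c | v ≟ d
... | yes v≡c | _       = inj₁ v≡c
... | no _    | yes v≡d = inj₂ v≡d
∈ₑ-sound () | no _ | no _

ends-determine-edge : ∀ {m} {a b c d : Fin m} → toℕ a ℕ.< toℕ b → toℕ c ℕ.< toℕ d →
  a ∈ₑ (c , d) ≡ true → b ∈ₑ (c , d) ≡ true → (c , d) ≡ (a , b)
ends-determine-edge {a = a} {b} {c} {d} a<b c<d a∈ b∈
  with ∈ₑ-sound {v = a} {c} {d} a∈ | ∈ₑ-sound {v = b} {c} {d} b∈
... | inj₁ refl | inj₂ refl = refl
... | inj₁ refl | inj₁ refl = ⊥-elim (ℕP.<-irrefl refl a<b)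
... | inj₂ refl | inj₂ refl = ⊥-elim (ℕP.<-irrefl refl a<b)
... | inj₂ refl | inj₁ refl = ⊥-elim (ℕP.<-asym a<b c<d)

[∈ₑ]-split : ∀ {m} {c d : Fin m} → c ≢ d → (x : ℤ) (v : Fin m) →
  [ v ∈ₑ (c , d) ]· x ≡ [ ⌊ v ≟ c ⌋ ]· x + [ ⌊ v ≟ d ⌋ ]· x
[∈ₑ]-split {c = c} {d} c≢d x v with v ≟ c | v ≟ d
... | yes refl | yes refl = ⊥-elim (c≢d refl)
... | yes _    | no _     = sym (ℤP.+-identityʳ x)
... | no _     | yes _    = sym (ℤP.+-identityˡ x)
... | no _     | no _     = refl

∑-ends : ∀ {m} {c d : Fin m} → c ≢ d → (x : ℤ) → ∑[ v < m ] ([ v ∈ₑ (c , d) ]· x) ≡ x + x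
∑-ends {m} {c} {d} c≢d x = begin
  ∑[ v < m ] ([ v ∈ₑ (c , d) ]· x)
    ≡⟨ sum-cong-≗ ([∈ₑ]-split c≢d x) ⟩
  ∑[ v < m ] ([ ⌊ v ≟ c ⌋ ]· x + [ ⌊ v ≟ d ⌋ ]· x)
    ≡⟨ ∑-distrib-+ (λ v → [ ⌊ v ≟ c ⌋ ]· x) (λ v → [ ⌊ v ≟ d ⌋ ]· x) ⟩
  ∑[ v < m ] ([ ⌊ v ≟ c ⌋ ]· x) + ∑[ v < m ] ([ ⌊ v ≟ d ⌋ ]· x)
    ≡⟨ cong₂ _+_ (∑-delta _ c (λ v v≢c → cong ([_]· x) (⌊≟⌋-off v≢c)))
                 (∑-delta _ d (λ v v≢d → cong ([_]· x) (⌊≟⌋-off v≢d))) ⟩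
  [ ⌊ c ≟ c ⌋ ]· x + [ ⌊ d ≟ d ⌋ ]· x
    ≡⟨ cong₂ (λ p q → [ p ]· x + [ q ]· x) (⌊≟⌋-diag c) (⌊≟⌋-diag d) ⟩
  x + x ∎

module _ (G : Graph) where

  isEdge⇒< : ∀ {c d} → isEdge G (c , d) ≡ true → toℕ c ℕ.< toℕ d
  isEdge⇒< {c} {d} cd =
    ℕP.<ᵇ⇒< (toℕ c) (toℕ d) (proj₁ (Equivalence.to T-∧ (Equivalence.from T-≡ cd)))

  adj⇒isEdge : ∀ {a b} → toℕ a ℕ.< toℕ b → adj G a b ≡ true → isEdge G (a , b) ≡ true
  adj⇒isEdge a<b ab =
    Equivalence.to T-≡ (Equivalence.from T-∧ (ℕP.<⇒<ᵇ a<b , Equivalence.from T-≡ ab))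

  isEdge⇒≢ : ∀ {c d} → isEdge G (c , d) ≡ true → c ≢ d
  isEdge⇒≢ cd refl = ℕP.<-irrefl refl (isEdge⇒< cd)

  shareEnd-∈ₑ : (a b : Fin (n G)) (e : Edge G) → shareEnd G (a , b) e ≡ (a ∈ₑ e ∨ b ∈ₑ e)
  shareEnd-∈ₑ a b (c , d) = sym (∨-assoc ⌊ a ≟ c ⌋ ⌊ a ≟ d ⌋ (b ∈ₑ (c , d)))

  module _ (f : EdgeFun G) where

    fv : Edge G → ℤ
    fv e = val (f e)

    fOnEdges : (Edge G → Bool) → Edge G → ℤ
    fOnEdges p e = [ isEdge G e ]· [ p e ]· fv e

    incidentSum : Fin (n G) → ℤ
    incidentSum v = ∑² (fOnEdges (v ∈ₑ_))

    weight≡∑² : weight G f ≡ ∑² (λ e → [ isEdge G e ]· fv e)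
    weight≡∑² = sumℤ-edges G fv

    nbhdSum≡∑² : ∀ e → nbhdSum G f e ≡ ∑² (fOnEdges (shareEnd G e))
    nbhdSum≡∑² e = trans (sumℤ-map-filter fv (shareEnd G e) (edges G)) (sumℤ-edges G _)

    handshake : ∑[ v < n G ] incidentSum v ≡ weight G f + weight G f
    handshake = begin
      ∑[ v < n G ] ∑[ c < n G ] ∑[ d < n G ] fOnEdges (v ∈ₑ_) (c , d)
        ≡⟨ ∑-comm (λ v c → ∑[ d < n G ] fOnEdges (v ∈ₑ_) (c , d)) ⟩
      ∑[ c < n G ] ∑[ v < n G ] ∑[ d < n G ] fOnEdges (v ∈ₑ_) (c , d)
        ≡⟨ sum-cong-≗ (λ c → ∑-comm (λ v d → fOnEdges (v ∈ₑ_) (c , d))) ⟩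
      ∑² (λ e → ∑[ v < n G ] fOnEdges (v ∈ₑ_) e)
        ≡⟨ ∑²-cong twoEnds ⟩
      ∑² (λ e → fE e + fE e)
        ≡⟨ ∑²-distrib-+ fE fE ⟩
      ∑² fE + ∑² fE
        ≡⟨ sym (cong₂ _+_ weight≡∑² weight≡∑²) ⟩
      weight G f + weight G f ∎
      where
      fE : Edge G → ℤ
      fE e = [ isEdge G e ]· fv e

      twoEnds : ∀ e → ∑[ v < n G ] fOnEdges (v ∈ₑ_) e ≡ fE e + fE e
      twoEnds (c , d) with isEdge G (c , d) in cd
      ... | true  = ∑-ends (isEdge⇒≢ cd) (fv (c , d))
      ... | false = sum-replicate-zero (n G)

    module _ {a b : Fin (n G)} (ab : isEdge G (a , b) ≡ true) where

      bothEnds : Edge G → Bool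
      bothEnds e = a ∈ₑ e ∧ b ∈ₑ e

      commonEdges : ∑² (fOnEdges bothEnds) ≡ fv (a , b)
      commonEdges = trans (∑²-delta (fOnEdges bothEnds) (a , b) vanish) atAB
        where
        vanish : ∀ e → e ≢ (a , b) → fOnEdges bothEnds e ≡ 0ℤ
        vanish (c , d) cd≢ab with isEdge G (c , d) in cd | a ∈ₑ (c , d) in a∈ | b ∈ₑ (c , d) in b∈
        ... | true  | true  | true  = ⊥-elim (cd≢ab (ends-determine-edge (isEdge⇒< ab) (isEdge⇒< cd) a∈ b∈))
        ... | true  | true  | false = refl
        ... | true  | false | _     = refl
        ... | false | _     | _     = refl

        atAB : fOnEdges bothEnds (a , b) ≡ fv (a , b)
        atAB rewrite ab | ⌊≟⌋-diag a | ⌊≟⌋-diag b | ∨-zeroʳ ⌊ b ≟ a ⌋ = refl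

      nbhd-decomposition : nbhdSum G f (a , b) + fv (a , b) ≡ incidentSum a + incidentSum b
      nbhd-decomposition = begin
        nbhdSum G f (a , b) + fv (a , b)
          ≡⟨ cong₂ _+_ (nbhdSum≡∑² (a , b)) (sym commonEdges) ⟩
        ∑² (fOnEdges (shareEnd G (a , b))) + ∑² (fOnEdges bothEnds)
          ≡⟨ sym (∑²-distrib-+ (fOnEdges (shareEnd G (a , b))) (fOnEdges bothEnds)) ⟩
        ∑² (λ e → fOnEdges (shareEnd G (a , b)) e + fOnEdges bothEnds e)
          ≡⟨ ∑²-cong inclusionExclusion ⟩
        ∑² (λ e → fOnEdges (a ∈ₑ_) e + fOnEdges (b ∈ₑ_) e)
          ≡⟨ ∑²-distrib-+ (fOnEdges (a ∈ₑ_)) (fOnEdges (b ∈ₑ_)) ⟩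
        incidentSum a + incidentSum b ∎
        where
        inclusionExclusion : ∀ e → fOnEdges (shareEnd G (a , b)) e + fOnEdges bothEnds e
                                   ≡ fOnEdges (a ∈ₑ_) e + fOnEdges (b ∈ₑ_) e
        inclusionExclusion e = begin
          [ isEdge G e ]· [ shareEnd G (a , b) e ]· fv e + [ isEdge G e ]· [ bothEnds e ]· fv e
            ≡⟨ sym ([]·-distrib-+ (isEdge G e) _ _) ⟩
          [ isEdge G e ]· ([ shareEnd G (a , b) e ]· fv e + [ bothEnds e ]· fv e)
            ≡⟨ cong (λ s → [ isEdge G e ]· ([ s ]· fv e + [ bothEnds e ]· fv e)) (shareEnd-∈ₑ a b e) ⟩
          [ isEdge G e ]· ([ a ∈ₑ e ∨ b ∈ₑ e ]· fv e + [ a ∈ₑ e ∧ b ∈ₑ e ]· fv e)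
            ≡⟨ cong ([ isEdge G e ]·_) ([]·-∨-∧ (a ∈ₑ e) (b ∈ₑ e) (fv e)) ⟩
          [ isEdge G e ]· ([ a ∈ₑ e ]· fv e + [ b ∈ₑ e ]· fv e)
            ≡⟨ []·-distrib-+ (isEdge G e) _ _ ⟩
          [ isEdge G e ]· [ a ∈ₑ e ]· fv e + [ isEdge G e ]· [ b ∈ₑ e ]· fv e ∎

      -- For an SEDF, f(E(a)) + f(E(b)) ≥ f(N[ab]) - 1 ≥ 0.
      edge-incidentSums-nonneg : IsSEDF G f → 0ℤ ≤ incidentSum a + incidentSum b
      edge-incidentSums-nonneg sedf =
        subst (0ℤ ≤_) nbhd-decomposition (ℤP.+-mono-≤ (sedf (a , b) ab) (-1≤val (f (a , b))))
        where
        -1≤val : ∀ s → -[1+ 0 ] ≤ val s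
        -1≤val Sign.+ = -≤+
        -1≤val Sign.- = ℤP.≤-refl

    adjacent-incidentSums-nonneg : IsSEDF G f → ∀ {u v} → adj G u v ≡ true →
      0ℤ ≤ incidentSum u + incidentSum v
    adjacent-incidentSums-nonneg sedf {u} {v} uv with ℕP.<-cmp (toℕ u) (toℕ v)
    ... | tri< u<v _ _ = edge-incidentSums-nonneg (adj⇒isEdge u<v uv) sedf
    ... | tri> _ _ v<u =
      subst (0ℤ ≤_) (ℤP.+-comm (incidentSum v) (incidentSum u))
        (edge-incidentSums-nonneg (adj⇒isEdge v<u (trans (Graph.sym G v u) uv)) sedf)
    ... | tri≈ _ u≡v _ with toℕ-injective u≡v
    ... | refl with trans (sym (irrefl G u)) uv
    ... | ()

double-nonneg : ∀ x → 0ℤ ≤ x + x → 0ℤ ≤ x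
double-nonneg (+ _)    _ = +≤+ ℕ.z≤n
double-nonneg -[1+ _ ] ()

positive-multiple-nonneg : ∀ k {x} → 0ℤ ≤ + suc k * x → 0ℤ ≤ x
positive-multiple-nonneg k {x} 0≤kx =
  ℤP.*-cancelˡ-≤-pos 0ℤ x (+ suc k) (subst (_≤ + suc k * x) (sym (ℤP.*-zeroʳ (+ suc k))) 0≤kx)

-- Let w be a symmetric ℕ-weighting of ordered pairs of Fin m with
-- all row sums equal to k + 1, and let s(v) + s(u) ≥ 0 wherever w(v,u) > 0.
-- Then Σ_v s(v) ≥ 0, because Σ_{v,u} w(v,u)(s(v) + s(u)) = 2(k+1) Σ_v s(v).
regular-weighting-nonneg : ∀ {m} (s : Fin m → ℤ) (w : Fin m → Fin m → ℕ) (k : ℕ) →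
  (∀ v u → w v u ≡ w u v) →
  (∀ v → ∑[ u < m ] (+ w v u) ≡ + suc k) →
  (∀ v u → 0 ℕ.< w v u → 0ℤ ≤ s v + s u) →
  0ℤ ≤ ∑[ v < m ] s v
regular-weighting-nonneg {m} s w k w-sym rows support =
  positive-multiple-nonneg k (double-nonneg (K * Σs) (subst (0ℤ ≤_) total≡ total-nonneg))
  where
  K Σs : ℤ
  K  = + suc k
  Σs = ∑[ v < m ] s v

  total : ℤ
  total = ∑[ v < m ] ∑[ u < m ] (+ w v u * (s v + s u))

  term-nonneg : ∀ v u → 0ℤ ≤ + w v u * (s v + s u)
  term-nonneg v u with w v u in wvu
  ... | zero  = ℤP.≤-refl
  ... | suc j = subst (_≤ + suc j * (s v + s u)) (ℤP.*-zeroʳ (+ suc j))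
                  (ℤP.*-monoˡ-≤-nonNeg (+ suc j) (support v u (subst (0 ℕ.<_) (sym wvu) (ℕ.s≤s ℕ.z≤n))))

  total-nonneg : 0ℤ ≤ total
  total-nonneg = ∑-nonneg _ (λ v → ∑-nonneg _ (term-nonneg v))

  rowPart : ∑[ v < m ] ∑[ u < m ] (+ w v u * s v) ≡ K * Σs
  rowPart = trans (sum-cong-≗ row) (sym (*-distribˡ-sum K s))
    where
    row : ∀ v → ∑[ u < m ] (+ w v u * s v) ≡ K * s v
    row v = trans (sym (*-distribʳ-sum (s v) (λ u → + w v u))) (cong (_* s v) (rows v))

  columnPart : ∑[ v < m ] ∑[ u < m ] (+ w v u * s u) ≡ ∑[ v < m ] ∑[ u < m ] (+ w v u * s v)
  columnPart = trans (∑-comm (λ v u → + w v u * s u))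
                     (sum-cong-≗ (λ u → sum-cong-≗ (λ v → cong (λ t → + t * s u) (w-sym v u))))

  total≡ : total ≡ K * Σs + K * Σs
  total≡ = begin
    total
      ≡⟨ sum-cong-≗ (λ v → trans (sum-cong-≗ (λ u → ℤP.*-distribˡ-+ (+ w v u) (s v) (s u)))
                                 (∑-distrib-+ (λ u → + w v u * s v) (λ u → + w v u * s u))) ⟩
    ∑[ v < m ] (∑[ u < m ] (+ w v u * s v) + ∑[ u < m ] (+ w v u * s u))
      ≡⟨ ∑-distrib-+ (λ v → ∑[ u < m ] (+ w v u * s v)) (λ v → ∑[ u < m ] (+ w v u * s u)) ⟩
    ∑[ v < m ] ∑[ u < m ] (+ w v u * s v) + ∑[ v < m ] ∑[ u < m ] (+ w v u * s u)
      ≡⟨ cong₂ _+_ rowPart (trans columnPart rowPart) ⟩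
    K * Σs + K * Σs ∎

-- 2 / d for the possible degrees d ∈ {1, 2} of a vertex of an elementary graph.
twoOver : ℕ → ℕ
twoOver 1 = 2
twoOver _ = 1

twoOver-inverse : ∀ d → d ≡ 1 ⊎ d ≡ 2 → d ℕ.* twoOver d ≡ 2
twoOver-inverse _ (inj₁ refl) = refl
twoOver-inverse _ (inj₂ refl) = refl

module _ {G : Graph} (H : EdgeSubgraph G) (H-elementary : IsSpanningElementary H) where

  elementaryWeight : Fin (n G) → Fin (n G) → ℕ
  elementaryWeight v u = if hadj H v u then twoOver (degH H v) else 0

  -- It is symmetric, since H-neighbours have equal H-degree.
  elementaryWeight-sym : ∀ v u → elementaryWeight v u ≡ elementaryWeight u v
  elementaryWeight-sym v u rewrite hsym H v u with hadj H u v in uv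
  ... | true  = cong twoOver (sym (proj₂ H-elementary u v uv))
  ... | false = refl

  elementaryWeight-rows : ∀ v → ∑[ u < n G ] (+ elementaryWeight v u) ≡ + 2
  elementaryWeight-rows v = begin
    ∑[ u < n G ] (+ elementaryWeight v u)
      ≡⟨ sum-cong-≗ (λ u → +-if (hadj H v u)) ⟩
    ∑[ u < n G ] ([ hadj H v u ]· + twoOver (degH H v))
      ≡⟨ ∑-count (hadj H v) (+ twoOver (degH H v)) ⟩
    + degH H v * + twoOver (degH H v)
      ≡⟨ sym (ℤP.pos-* (degH H v) (twoOver (degH H v))) ⟩
    + (degH H v ℕ.* twoOver (degH H v))
      ≡⟨ cong +_ (twoOver-inverse (degH H v) (proj₁ H-elementary v)) ⟩
    + 2 ∎
    where
    +-if : ∀ b {t} → + (if b then t else 0) ≡ [ b ]· + t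
    +-if true  = refl
    +-if false = refl

  elementaryWeight-support : ∀ {v u} → 0 ℕ.< elementaryWeight v u → hadj H v u ≡ true
  elementaryWeight-support {v} {u} pos with hadj H v u
  ... | true = refl
  elementaryWeight-support () | false

mainTheorem6 : (G : Graph) → HasEdge G → HasSpanningElementary G →
    (f : EdgeFun G) → IsSEDF G f → + 0 ≤ weight G f
mainTheorem6 G _ (H , H-elementary) f sedf =
  double-nonneg (weight G f) (subst (0ℤ ≤_) (handshake G f) incidentSums-nonneg)
  where
  incidentSums-nonneg : 0ℤ ≤ ∑[ v < n G ] incidentSum G f v
  incidentSums-nonneg =
    regular-weighting-nonneg (incidentSum G f) (elementaryWeight H H-elementary) 1
      (elementaryWeight-sym H H-elementary)
      (elementaryWeight-rows H H-elementary)
      (λ v u pos → adjacent-incidentSums-nonneg G f sedf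
                     (hsub H v u (elementaryWeight-support H H-elementary pos)))
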